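{- A graph $G$ is complete if and only if $W(G)=PW(G)=WW(G)=PWW(G)$.
   Context: All graphs are finite, simple, undirected, connected and have at least two vertices. $d(u,v)$ is the shortest-path distance. The eccentricity of $v$ is $\max_u d(u,v)$; the diameter is the maximum eccentricity; a vertex is peripheral if its eccentricity equals the diameter, and $\operatorname{Peri}(G)$ is the set of peripheral vertices. Sums below range over unordered pairs $\{u,v\}$ of distinct vertices. Wiener index: $W(G)=\sum_{\{u,v\}\subseteq V(G)} d(u,v)$. Hyper-Wiener index: $WW(G)=\frac12\sum_{\{u,v\}\subseteq V(G)}(d(u,v)+d(u,v)^2)$. Peripheral Wiener index: $PW(G)=\sum_{\{u,v\}\subseteq \operatorname{Peri}(G)} d(u,v)$. Peripheral hyper-Wiener index: $PWW(G)=\frac12\sum_{\{u,v\}\subseteq \operatorname{Peri}(G)}(d(u,v)+d(u,v)^2)$. -}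

module Defs where

open import Data.Nat using (ℕ; zero; suc; _+_; _*_; _≤_; _<_; _/_; _⊔_; _<ᵇ_)
open import Data.Nat.Properties using (_≟_)
open import Data.Bool using (Bool; true; false; _∧_; _∨_; if_then_else_)
open import Data.Fin using (Fin; toℕ)
open import Data.Fin.Properties using () renaming (_≟_ to _≟ᶠ_)
open import Data.List using (List; []; _∷_; map; foldr; allFin)
open import Data.Nat.ListAction using (sum)
open import Data.Bool.ListAction using (any)
open import Data.Product using (∃; _×_)
open import Relation.Nullary using (¬_; does)
open import Relation.Binary.PropositionalEquality using (_≡_; _≢_)

record Graph : Set where
  field
    n      : ℕ
    adj    : Fin n → Fin n → Bool
    sym    : ∀ u v → adj u v ≡ adj v u
    irrefl : ∀ v → adj v v ≡ false
open Graph public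

data Walk (G : Graph) : Fin (n G) → Fin (n G) → ℕ → Set where
  here : ∀ {u} → Walk G u u 0
  step : ∀ {u w v k} → adj G u w ≡ true → Walk G w v k → Walk G u v (suc k)

Connected : Graph → Set
Connected G = ∀ u v → ∃ λ k → Walk G u v k

Complete : Graph → Set
Complete G = ∀ u v → u ≢ v → adj G u v ≡ true

reach : (G : Graph) → ℕ → Fin (n G) → Fin (n G) → Bool
reach G zero    u v = does (u ≟ᶠ v)
reach G (suc k) u v = reach G k u v ∨ any (λ w → adj G u w ∧ reach G k w v) (allFin (n G))

-- least k < bound with reach k u v, searching from k = i; returns bound if none
searchDist : (G : Graph) → Fin (n G) → Fin (n G) → (i fuel : ℕ) → ℕ
searchDist G u v i zero       = i
searchDist G u v i (suc fuel) = if reach G i u v then i else searchDist G u v (suc i) fuel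

-- shortest-path distance (in a connected graph every distance is < n)
dist : (G : Graph) → Fin (n G) → Fin (n G) → ℕ
dist G u v = searchDist G u v 0 (n G)

maxL : List ℕ → ℕ
maxL = foldr _⊔_ 0

ecc : (G : Graph) → Fin (n G) → ℕ
ecc G v = maxL (map (λ u → dist G u v) (allFin (n G)))

diam : Graph → ℕ
diam G = maxL (map (ecc G) (allFin (n G)))

isPeripheral : (G : Graph) → Fin (n G) → Bool
isPeripheral G v = does (ecc G v ≟ diam G)

pairSum : (G : Graph) → (Fin (n G) → Bool) → (ℕ → ℕ) → ℕ
pairSum G P f =
  sum (map (λ u → sum (map (λ v →
        if (toℕ u <ᵇ toℕ v) ∧ P u ∧ P v then f (dist G u v) else 0)
      (allFin (n G)))) (allFin (n G)))

W : Graph → ℕ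
W G = pairSum G (λ _ → true) (λ d → d)

-- (the sum of d + d² is even, so halving is exact)
WW : Graph → ℕ
WW G = pairSum G (λ _ → true) (λ d → d + d * d) / 2

PW : Graph → ℕ
PW G = pairSum G (isPeripheral G) (λ d → d)

PWW : Graph → ℕ
PWW G = pairSum G (isPeripheral G) (λ d → d + d * d) / 2

{-# OPTIONS --safe #-}
module Submission where

-- In a complete graph every distance between distinct vertices is 1, so every
-- eccentricity is 1, every vertex is peripheral (W = PW, WW = PWW), and
-- d + d² = 2d on every pair (W = WW). Conversely d + d² = 2d + d(d − 1), so
-- WW = W + ½ Σ d(d − 1); hence W = WW forces d(d − 1) ≤ 1, i.e. d ≤ 1, for
-- every pair, and G is complete.

open import Algebra.Properties.CommutativeSemigroup using (interchange)
open import Data.Bool using (Bool; true; false; _∧_; if_then_else_; T)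
open import Data.Bool.Properties using (T-≡; T-∧; T-∨; if-eta; if-cong-then)
open import Data.Empty using (⊥-elim)
open import Data.Fin using (Fin; toℕ; punchIn; fromℕ<) renaming (zero to fzero)
import Data.Fin.Properties as Finₚ
open import Data.Fin.Properties using (punchInᵢ≢i; nonZeroIndex) renaming (_≟_ to _≟ᶠ_)
open import Data.List using (List; []; _∷_; map; allFin)
open import Data.List.Properties using (map-cong)
open import Data.List.Membership.Propositional using (_∈_; lose)
open import Data.List.Membership.Propositional.Properties using (∈-allFin)
open import Data.List.Relation.Unary.Any using (here; there; satisfied)
open import Data.List.Relation.Unary.Any.Properties using (any⁺; any⁻)
open import Data.Nat using (ℕ; zero; suc; pred; _+_; _*_; _/_; _≤_; _<_; _<ᵇ_; NonZero; z≤n; s≤s)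
open import Data.Nat.DivMod using (m*n/n≡m; +-distrib-/-∣ˡ; m/n≡0⇒m<n)
open import Data.Nat.Divisibility using (divides-refl)
open import Data.Nat.ListAction using (sum)
open import Data.Nat.Properties
open import Data.Product using (∃; _×_; _,_; uncurry)
open import Data.Sum using (inj₂)
open import Defs hiding (sym)
open import Function.Base using (id)
open import Function.Bundles using (_⇔_; mk⇔; Equivalence)
open import Relation.Binary.Definitions using (tri<; tri≈; tri>)
open import Relation.Binary.PropositionalEquality
  using (_≡_; _≢_; refl; sym; trans; cong; cong₂; module ≡-Reasoning)
open import Relation.Nullary using (does; yes; no; contradiction)
open import Relation.Nullary.Decidable using (dec-true; dec-false)

module _ {A : Set} where

  sum-map-+ : (f g : A → ℕ) (xs : List A) →
              sum (map (λ x → f x + g x) xs) ≡ sum (map f xs) + sum (map g xs)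
  sum-map-+ f g []       = refl
  sum-map-+ f g (x ∷ xs) =
    trans (cong (f x + g x +_) (sum-map-+ f g xs))
          (interchange +-commutativeSemigroup (f x) (g x) (sum (map f xs)) (sum (map g xs)))

  sum-map-≡0 : (f : A → ℕ) → (∀ x → f x ≡ 0) → (xs : List A) → sum (map f xs) ≡ 0
  sum-map-≡0 f f≡0 []       = refl
  sum-map-≡0 f f≡0 (x ∷ xs) = cong₂ _+_ (f≡0 x) (sum-map-≡0 f f≡0 xs)

  ∈⇒≤sum-map : (f : A → ℕ) {x : A} {xs : List A} → x ∈ xs → f x ≤ sum (map f xs)
  ∈⇒≤sum-map f (here refl)               = m≤m+n _ _
  ∈⇒≤sum-map f {xs = y ∷ _} (there x∈xs) = ≤-trans (∈⇒≤sum-map f x∈xs) (m≤n+m _ (f y))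

  maxL-map-≤ : (f : A → ℕ) {c : ℕ} → (∀ x → f x ≤ c) → (xs : List A) → maxL (map f xs) ≤ c
  maxL-map-≤ f f≤c []       = z≤n
  maxL-map-≤ f f≤c (x ∷ xs) = ⊔-lub (f≤c x) (maxL-map-≤ f f≤c xs)

  ∈⇒≤maxL-map : (f : A → ℕ) {x : A} {xs : List A} → x ∈ xs → f x ≤ maxL (map f xs)
  ∈⇒≤maxL-map f (here refl)              = m≤m⊔n _ _
  ∈⇒≤maxL-map f {xs = y ∷ _} (there x∈xs) = ≤-trans (∈⇒≤maxL-map f x∈xs) (m≤n⊔m (f y) _)

  maxL-map-attained : (f : A → ℕ) {c : ℕ} {x : A} {xs : List A} →
                      (∀ y → f y ≤ c) → x ∈ xs → f x ≡ c → maxL (map f xs) ≡ c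
  maxL-map-attained f {xs = xs} f≤c x∈xs fx≡c =
    ≤-antisym (maxL-map-≤ f f≤c xs) (≤-trans (≤-reflexive (sym fx≡c)) (∈⇒≤maxL-map f x∈xs))

∃≢ : ∀ {m} → 2 ≤ m → (v : Fin m) → ∃ λ u → u ≢ v
∃≢ (s≤s (s≤s _)) v = punchIn v fzero , punchInᵢ≢i v fzero

m+[m+n]/2≡m+n/2 : ∀ m n → (m + (m + n)) / 2 ≡ m + n / 2
m+[m+n]/2≡m+n/2 m n = begin
  (m + (m + n)) / 2  ≡⟨ cong (_/ 2) (sym (+-assoc m m n)) ⟩
  (m + m + n) / 2    ≡⟨ cong (λ k → (k + n) / 2) m+m≡m*2 ⟩
  (m * 2 + n) / 2    ≡⟨ +-distrib-/-∣ˡ n (divides-refl m) ⟩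
  m * 2 / 2 + n / 2  ≡⟨ cong (_+ n / 2) (m*n/n≡m m 2) ⟩
  m + n / 2          ∎
  where
  open ≡-Reasoning
  m+m≡m*2 : m + m ≡ m * 2
  m+m≡m*2 = trans (cong (m +_) (sym (+-identityʳ m))) (*-comm 2 m)

n+n*n≡n+[n+pred[n]*n] : ∀ n → n + n * n ≡ n + (n + pred n * n)
n+n*n≡n+[n+pred[n]*n] zero    = refl
n+n*n≡n+[n+pred[n]*n] (suc n) = refl

n≤1⇒pred[n]*n≡0 : ∀ {n} → n ≤ 1 → pred n * n ≡ 0
n≤1⇒pred[n]*n≡0 z≤n       = refl
n≤1⇒pred[n]*n≡0 (s≤s z≤n) = refl

pred[n]*n<2⇒n≤1 : ∀ n → pred n * n < 2 → n ≤ 1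
pred[n]*n<2⇒n≤1 zero          _ = z≤n
pred[n]*n<2⇒n≤1 (suc zero)    _ = s≤s z≤n
pred[n]*n<2⇒n≤1 (suc (suc n)) (s≤s (s≤s ()))

module _ (G : Graph) where

  i≤searchDist : ∀ u v i fuel → i ≤ searchDist G u v i fuel
  i≤searchDist u v i zero       = ≤-refl
  i≤searchDist u v i (suc fuel) with reach G i u v
  ... | true  = ≤-refl
  ... | false = ≤-trans (n≤1+n i) (i≤searchDist u v (suc i) fuel)

  dist-self : ∀ u → dist G u u ≡ 0
  dist-self u = searchDist-self (n G)
    where
    searchDist-self : ∀ fuel → searchDist G u u 0 fuel ≡ 0
    searchDist-self zero    = refl
    searchDist-self (suc _) rewrite dec-true (u ≟ᶠ u) refl = refl

  adj⇒≢ : ∀ {u v} → adj G u v ≡ true → u ≢ v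
  adj⇒≢ {u} uv refl with () ← trans (sym uv) (irrefl G u)

  adj⇒reach₁ : ∀ {u v} → adj G u v ≡ true → T (reach G 1 u v)
  adj⇒reach₁ {u} {v} uv = Equivalence.from T-∨ (inj₂ (any⁺ _ (lose (∈-allFin v) edge)))
    where
    edge : T (adj G u v ∧ does (v ≟ᶠ v))
    edge rewrite uv | dec-true (v ≟ᶠ v) refl = _

  reach₁⇒adj : ∀ {u v} → u ≢ v → T (reach G 1 u v) → adj G u v ≡ true
  reach₁⇒adj {u} {v} u≢v r rewrite dec-false (u ≟ᶠ v) u≢v =
    uncurry edge (satisfied (any⁻ (λ w → adj G u w ∧ does (w ≟ᶠ v)) (allFin (n G)) r))
    where
    edge : ∀ w → T (adj G u w ∧ does (w ≟ᶠ v)) → adj G u v ≡ true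
    edge w t with Equivalence.to (T-∧ {adj G u w}) t
    ... | uw , w≟v with w ≟ᶠ v
    ...   | yes refl = Equivalence.to T-≡ uw
    ...   | no _     = ⊥-elim w≟v

  searchDist-≢ : ∀ {u v} → u ≢ v → ∀ fuel → searchDist G u v 0 (suc fuel) ≡ searchDist G u v 1 fuel
  searchDist-≢ {u} {v} u≢v fuel rewrite dec-false (u ≟ᶠ v) u≢v = refl

  searchDist-adj : ∀ {u v} fuel .{{_ : NonZero fuel}} → adj G u v ≡ true → searchDist G u v 0 fuel ≡ 1
  searchDist-adj (suc zero)       uv rewrite searchDist-≢ (adj⇒≢ uv) 0 = refl
  searchDist-adj (suc (suc fuel)) uv
    rewrite searchDist-≢ (adj⇒≢ uv) (suc fuel) | Equivalence.to T-≡ (adj⇒reach₁ uv) = refl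

  dist-adj : ∀ {u v} → adj G u v ≡ true → dist G u v ≡ 1
  dist-adj {u} = searchDist-adj (n G) {{nonZeroIndex u}}

  dist≤1⇒adj : ∀ {u v} → 2 ≤ n G → u ≢ v → dist G u v ≤ 1 → adj G u v ≡ true
  dist≤1⇒adj {u} {v} 2≤n u≢v = searchDist≤1⇒adj (n G) 2≤n
    where
    searchDist≤1⇒adj : ∀ fuel → 2 ≤ fuel → searchDist G u v 0 fuel ≤ 1 → adj G u v ≡ true
    searchDist≤1⇒adj (suc (suc fuel)) (s≤s (s≤s _)) d≤1
      rewrite searchDist-≢ u≢v (suc fuel) with reach G 1 u v in r
    ... | true  = reach₁⇒adj u≢v (Equivalence.from T-≡ r)
    ... | false = contradiction (≤-trans (i≤searchDist u v 2 fuel) d≤1) 1+n≰n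

  Complete⇒dist≤1 : Complete G → ∀ u v → dist G u v ≤ 1
  Complete⇒dist≤1 c u v with u ≟ᶠ v
  ... | yes refl = ≤-trans (≤-reflexive (dist-self u)) z≤n
  ... | no u≢v   = ≤-reflexive (dist-adj (c u v u≢v))

  Complete⇒ecc≡1 : 2 ≤ n G → Complete G → ∀ v → ecc G v ≡ 1
  Complete⇒ecc≡1 2≤n c v with ∃≢ 2≤n v
  ... | u , u≢v = maxL-map-attained (λ w → dist G w v) (λ w → Complete⇒dist≤1 c w v)
                                    (∈-allFin u) (dist-adj (c u v u≢v))

  Complete⇒diam≡1 : 2 ≤ n G → Complete G → diam G ≡ 1
  Complete⇒diam≡1 2≤n c = maxL-map-attained (ecc G) (λ v → ≤-reflexive (ecc≡1 v))
                                            (∈-allFin v₀) (ecc≡1 v₀)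
    where
    ecc≡1 : ∀ v → ecc G v ≡ 1
    ecc≡1 = Complete⇒ecc≡1 2≤n c
    v₀ : Fin (n G)
    v₀ = fromℕ< (≤-trans (s≤s z≤n) 2≤n)

  Complete⇒isPeripheral : 2 ≤ n G → Complete G → ∀ v → isPeripheral G v ≡ true
  Complete⇒isPeripheral 2≤n c v =
    dec-true (ecc G v ≟ diam G) (trans (Complete⇒ecc≡1 2≤n c v) (sym (Complete⇒diam≡1 2≤n c)))

  vertices : List (Fin (n G))
  vertices = allFin (n G)

  everyVertex : Fin (n G) → Bool
  everyVertex _ = true

  pairTerm : (Fin (n G) → Bool) → (ℕ → ℕ) → Fin (n G) → Fin (n G) → ℕ
  pairTerm P f u v = if (toℕ u <ᵇ toℕ v) ∧ P u ∧ P v then f (dist G u v) else 0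

  rowSum : (Fin (n G) → Bool) → (ℕ → ℕ) → Fin (n G) → ℕ
  rowSum P f u = sum (map (pairTerm P f u) vertices)

  pairSum-congTerm : ∀ P Q f g → (∀ u v → pairTerm P f u v ≡ pairTerm Q g u v) →
                     pairSum G P f ≡ pairSum G Q g
  pairSum-congTerm P Q f g t≡t = cong sum (map-cong (λ u → cong sum (map-cong (t≡t u) vertices)) vertices)

  pairSum-everyVertex : ∀ P f → (∀ v → P v ≡ true) → pairSum G everyVertex f ≡ pairSum G P f
  pairSum-everyVertex P f P≡true = pairSum-congTerm everyVertex P f f term
    where
    term : ∀ u v → pairTerm everyVertex f u v ≡ pairTerm P f u v
    term u v rewrite P≡true u | P≡true v = refl

  pairSum-cong : ∀ P f g → (∀ u v → toℕ u < toℕ v → f (dist G u v) ≡ g (dist G u v)) →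
                 pairSum G P f ≡ pairSum G P g
  pairSum-cong P f g f≡g = pairSum-congTerm P P f g term
    where
    term : ∀ u v → pairTerm P f u v ≡ pairTerm P g u v
    term u v with toℕ u <ᵇ toℕ v in u<ᵇv
    ... | false = refl
    ... | true  = if-cong-then (P u ∧ P v) (f≡g u v (<ᵇ⇒< _ _ (Equivalence.from T-≡ u<ᵇv)))

  pairSum-+ : ∀ P f g → pairSum G P (λ d → f d + g d) ≡ pairSum G P f + pairSum G P g
  pairSum-+ P f g =
    trans (cong sum (map-cong row vertices)) (sum-map-+ (rowSum P f) (rowSum P g) vertices)
    where
    term : ∀ u v → pairTerm P (λ d → f d + g d) u v ≡ pairTerm P f u v + pairTerm P g u v
    term u v with (toℕ u <ᵇ toℕ v) ∧ P u ∧ P v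
    ... | true  = refl
    ... | false = refl
    row : ∀ u → rowSum P (λ d → f d + g d) u ≡ rowSum P f u + rowSum P g u
    row u = trans (cong sum (map-cong (term u) vertices))
                  (sum-map-+ (pairTerm P f u) (pairTerm P g u) vertices)

  pairSum-≡0 : ∀ P f → (∀ u v → toℕ u < toℕ v → f (dist G u v) ≡ 0) → pairSum G P f ≡ 0
  pairSum-≡0 P f f≡0 =
    trans (pairSum-cong P f (λ _ → 0) f≡0) (sum-map-≡0 (rowSum P (λ _ → 0)) row vertices)
    where
    row : ∀ u → rowSum P (λ _ → 0) u ≡ 0
    row u = sum-map-≡0 (pairTerm P (λ _ → 0) u) (λ v → if-eta ((toℕ u <ᵇ toℕ v) ∧ P u ∧ P v)) vertices

  ≤pairSum : ∀ P f {u v} → toℕ u < toℕ v → P u ≡ true → P v ≡ true → f (dist G u v) ≤ pairSum G P f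
  ≤pairSum P f {u} {v} u<v Pu Pv = begin
    f (dist G u v)    ≡⟨ term ⟨
    pairTerm P f u v  ≤⟨ ∈⇒≤sum-map (pairTerm P f u) (∈-allFin v) ⟩
    rowSum P f u      ≤⟨ ∈⇒≤sum-map (rowSum P f) (∈-allFin u) ⟩
    pairSum G P f     ∎
    where
    open ≤-Reasoning
    term : pairTerm P f u v ≡ f (dist G u v)
    term rewrite Equivalence.to T-≡ (<⇒<ᵇ u<v) | Pu | Pv = refl

  -- Σ d(d − 1) over all pairs: it vanishes exactly when every distance is at most 1.
  excess : ℕ
  excess = pairSum G everyVertex (λ d → pred d * d)

  WW≡W+excess/2 : WW G ≡ W G + excess / 2
  WW≡W+excess/2 = begin
    S (λ d → d + d * d) / 2
      ≡⟨ cong (_/ 2) (pairSum-cong everyVertex (λ d → d + d * d) (λ d → d + (d + pred d * d)) split) ⟩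
    S (λ d → d + (d + pred d * d)) / 2
      ≡⟨ cong (_/ 2) (pairSum-+ everyVertex id (λ d → d + pred d * d)) ⟩
    (W G + S (λ d → d + pred d * d)) / 2
      ≡⟨ cong (λ k → (W G + k) / 2) (pairSum-+ everyVertex id (λ d → pred d * d)) ⟩
    (W G + (W G + excess)) / 2      ≡⟨ m+[m+n]/2≡m+n/2 (W G) excess ⟩
    W G + excess / 2                ∎
    where
    open ≡-Reasoning
    S : (ℕ → ℕ) → ℕ
    S = pairSum G everyVertex
    split : ∀ u v → toℕ u < toℕ v → let d = dist G u v in d + d * d ≡ d + (d + pred d * d)
    split u v _ = n+n*n≡n+[n+pred[n]*n] (dist G u v)

  dist≤1⇒W≡WW : (∀ u v → dist G u v ≤ 1) → W G ≡ WW G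
  dist≤1⇒W≡WW d≤1 = begin
    W G               ≡⟨ +-identityʳ (W G) ⟨
    W G + 0           ≡⟨ cong (λ k → W G + k / 2) excess≡0 ⟨
    W G + excess / 2  ≡⟨ WW≡W+excess/2 ⟨
    WW G              ∎
    where
    open ≡-Reasoning
    excess≡0 : excess ≡ 0
    excess≡0 = pairSum-≡0 everyVertex (λ d → pred d * d) λ u v _ → n≤1⇒pred[n]*n≡0 (d≤1 u v)

  W≡WW⇒dist≤1 : W G ≡ WW G → ∀ u v → toℕ u < toℕ v → dist G u v ≤ 1
  W≡WW⇒dist≤1 W≡WW u v u<v =
    pred[n]*n<2⇒n≤1 (dist G u v) (≤-<-trans (≤pairSum everyVertex (λ d → pred d * d) u<v refl refl)
                                             excess<2)
    where
    excess/2≡0 : excess / 2 ≡ 0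
    excess/2≡0 = +-cancelˡ-≡ (W G) _ _ (trans (sym (trans W≡WW WW≡W+excess/2))
                                              (sym (+-identityʳ (W G))))
    excess<2 : excess < 2
    excess<2 = m/n≡0⇒m<n excess/2≡0

  ordered-adj⇒Complete : (∀ u v → toℕ u < toℕ v → adj G u v ≡ true) → Complete G
  ordered-adj⇒Complete adj< u v u≢v with Finₚ.<-cmp u v
  ... | tri< u<v _ _ = adj< u v u<v
  ... | tri≈ _ u≡v _ = contradiction u≡v u≢v
  ... | tri> _ _ v<u = trans (Graph.sym G u v) (adj< v u v<u)

mainTheorem2 : (G : Graph) → 2 ≤ n G → Connected G →
               (Complete G ⇔ ((W G ≡ PW G) × (PW G ≡ WW G) × (WW G ≡ PWW G)))
mainTheorem2 G 2≤n _ = mk⇔ indices-equal complete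
  where
  indices-equal : Complete G → (W G ≡ PW G) × (PW G ≡ WW G) × (WW G ≡ PWW G)
  indices-equal c = W≡PW , trans (sym W≡PW) W≡WW , WW≡PWW
    where
    peripheral : ∀ v → isPeripheral G v ≡ true
    peripheral = Complete⇒isPeripheral G 2≤n c
    W≡PW : W G ≡ PW G
    W≡PW = pairSum-everyVertex G (isPeripheral G) id peripheral
    W≡WW : W G ≡ WW G
    W≡WW = dist≤1⇒W≡WW G (Complete⇒dist≤1 G c)
    WW≡PWW : WW G ≡ PWW G
    WW≡PWW = cong (_/ 2) (pairSum-everyVertex G (isPeripheral G) (λ d → d + d * d) peripheral)

  complete : (W G ≡ PW G) × (PW G ≡ WW G) × (WW G ≡ PWW G) → Complete G
  complete (W≡PW , PW≡WW , _) = ordered-adj⇒Complete G λ u v u<v →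
    dist≤1⇒adj G 2≤n (Finₚ.<⇒≢ u<v) (W≡WW⇒dist≤1 G (trans W≡PW PW≡WW) u v u<v)
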